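{- For every finite simple graph $G$ and every integer $r\ge 2$, $\dfrac{Z_{(r)}(G)}{r}\ge Z^-(G)$.
   Context: Skew zero forcing: initially some set of vertices of $G$ is blue and the rest white; if $w$ is the only white neighbor of any vertex $u$ (blue or white), then $u$ may color $w$ blue. $Z^-(G)$ is the minimum cardinality of an initial blue set from which all vertices can be made blue. For $r\in\mathbb{N}$, the $r$-blowup $G^{(r)}$ is obtained by replacing each vertex $u$ by an independent set $R_u$ of $r$ vertices and each edge $uw$ by all edges between $R_u$ and $R_w$. $r$-fold forcing game: an initial set $B\subseteq V(G^{(r)})$ is blue, the rest white; at each step, with $B_t$ the current blue set, a vertex $u\in B_t$ with $|N(u)\setminus B_t|\le r$ colors all of $N(u)\setminus B_t$ blue. $Z_{(r)}(G)$ is the minimum cardinality of an initial blue set from which all of $G^{(r)}$ can be made blue. -}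

module Defs where

open import Data.Bool using (Bool; true; false)
open import Data.Nat using (ℕ; _≤_; _≡ᵇ_)
open import Data.Nat as ℕ using ()
open import Data.Fin using (Fin; quotient)
open import Data.Fin.Subset using (Subset; ⊤; _∈_; _∩_; _∪_; ∁; ∣_∣)
open import Data.Vec using (tabulate)
open import Data.Product using (Σ; _×_; _,_)
open import Relation.Binary.PropositionalEquality using (_≡_)
open import Relation.Binary.Construct.Closure.ReflexiveTransitive using (Star)

record SimpleGraph (n : ℕ) : Set where
  field
    adj    : Fin n → Fin n → Bool
    sym    : ∀ i j → adj i j ≡ adj j i
    irrefl : ∀ i → adj i i ≡ false
open SimpleGraph public

Adj : ℕ → Set
Adj n = Fin n → Fin n → Bool

N : ∀ {n} → Adj n → Fin n → Subset n
N a u = tabulate (a u)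

white : ∀ {n} → Adj n → Subset n → Fin n → Subset n
white a B u = N a u ∩ ∁ B

-- one skew forcing step: any vertex u (blue or white) with exactly one
-- white neighbour w colours w blue
data SkewStep {n} (a : Adj n) : Subset n → Subset n → Set where
  force : ∀ B u → ∣ white a B u ∣ ≡ 1 → SkewStep a B (B ∪ white a B u)

data FoldStep {n} (r : ℕ) (a : Adj n) : Subset n → Subset n → Set where
  force : ∀ B u → u ∈ B → ∣ white a B u ∣ ≤ r → FoldStep r a B (B ∪ white a B u)

SkewForcingSet : ∀ {n} → SimpleGraph n → Subset n → Set
SkewForcingSet G B = Star (SkewStep (adj G)) B ⊤

-- the r-blowup G^(r): vertex set Fin (n * r); vertex i lies in the class
-- R_u with u = quotient r i; classes are independent, and R_u, R_w are
-- completely joined iff u w is an edge of G.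
blowupAdj : ∀ {n} → SimpleGraph n → (r : ℕ) → Adj (n ℕ.* r)
blowupAdj G r i j = adj G (quotient r i) (quotient r j)

FoldForcingSet : ∀ {n} → SimpleGraph n → (r : ℕ) → Subset (n ℕ.* r) → Set
FoldForcingSet G r B = Star (FoldStep r (blowupAdj G r)) B ⊤

IsZskew : ∀ {n} → SimpleGraph n → ℕ → Set
IsZskew G k =
  (Σ _ λ B → SkewForcingSet G B × ∣ B ∣ ≡ k) ×
  (∀ B → SkewForcingSet G B → k ≤ ∣ B ∣)

IsZfold : ∀ {n} → SimpleGraph n → ℕ → ℕ → Set
IsZfold G r k =
  (Σ _ λ B → FoldForcingSet G r B × ∣ B ∣ ≡ k) ×
  (∀ B → FoldForcingSet G r B → k ≤ ∣ B ∣)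

module Submission where

-- Read a fold forcing process on G^(r) backwards, keeping a set S of vertices
-- of G such that every class R_v with v ∉ S still contains a white vertex. Then
-- S is a skew forcing set with r ∣S∣ ≤ ∣B∣. A fold force by u ∈ R_c that turns
-- some x ∈ R_w blue makes every neighbour class of c entirely blue, so all
-- neighbours of c lie in S; dropping w from S leaves w the unique white
-- neighbour of c, which skew forces it back. So S shrinks by one vertex while
-- the blue set shrinks by at most r.

open import Defs hiding (sym)
open import Data.Nat using (ℕ; _≤_; _*_)
open import Data.Nat as ℕ using (z≤n; s≤s; suc; _+_)
open import Data.Nat.Properties as ℕ using ()
open import Data.Bool using (true)
open import Data.Fin using (Fin; quotient) renaming (_≟_ to _≟ᶠ_)
open import Data.Fin.Subset
  using (Subset; ⊤; _∈_; _∉_; _∪_; ∁; ∣_∣; _─_; _-_; ⁅_⁆; inside; outside; _⊆_)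
open import Data.Fin.Subset.Properties
open import Data.Vec using ([]; _∷_; here; there)
open import Data.Vec.Properties using (lookup∘tabulate; []=⇒lookup; lookup⇒[]=)
open import Data.Product using (∃-syntax; _×_; _,_; proj₁; proj₂)
open import Data.Sum using (inj₁; inj₂)
open import Data.Empty using (⊥-elim)
open import Relation.Nullary using (yes; no)
open import Relation.Binary.PropositionalEquality
open import Relation.Binary.Construct.Closure.ReflexiveTransitive using (ε; _◅_)

∣p∪q∣≤∣p∣+∣q∣ : ∀ {n} (p q : Subset n) → ∣ p ∪ q ∣ ≤ ∣ p ∣ + ∣ q ∣
∣p∪q∣≤∣p∣+∣q∣ []            []            = z≤n
∣p∪q∣≤∣p∣+∣q∣ (outside ∷ p) (outside ∷ q) = ∣p∪q∣≤∣p∣+∣q∣ p q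
∣p∪q∣≤∣p∣+∣q∣ (outside ∷ p) (inside ∷ q)
  rewrite ℕ.+-suc ∣ p ∣ ∣ q ∣ = s≤s (∣p∪q∣≤∣p∣+∣q∣ p q)
∣p∪q∣≤∣p∣+∣q∣ (inside ∷ p)  (s ∷ q)       =
  s≤s (ℕ.≤-trans (∣p∪q∣≤∣p∣+∣q∣ p q) (ℕ.+-monoʳ-≤ ∣ p ∣ (∣p∣≤∣x∷p∣ s q)))

x∈p─q⇒x∉q : ∀ {n} {x : Fin n} (p q : Subset n) → x ∈ p ─ q → x ∉ q
x∈p─q⇒x∉q (_ ∷ p) (_ ∷ q) (there x∈p─q) (there x∈q) = x∈p─q⇒x∉q p q x∈p─q x∈q

x∈p⇒p-x∪⁅x⁆≡p : ∀ {n} {x : Fin n} {p : Subset n} → x ∈ p → (p - x) ∪ ⁅ x ⁆ ≡ p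
x∈p⇒p-x∪⁅x⁆≡p {x = x} {p} x∈p = ⊆-antisym ⊆p p⊆
  where
  ⊆p : (p - x) ∪ ⁅ x ⁆ ⊆ p
  ⊆p y∈ with x∈p∪q⁻ (p - x) ⁅ x ⁆ y∈
  ... | inj₁ y∈p-x = p─q⊆p p ⁅ x ⁆ y∈p-x
  ... | inj₂ y∈⁅x⁆ rewrite x∈⁅y⁆⇒x≡y x y∈⁅x⁆ = x∈p
  p⊆ : p ⊆ (p - x) ∪ ⁅ x ⁆
  p⊆ {y} y∈p with y ≟ᶠ x
  ... | yes refl = q⊆p∪q (p - x) ⁅ x ⁆ (x∈⁅x⁆ x)
  ... | no y≢x   = p⊆p∪q ⁅ x ⁆ (x∈p∧x≢y⇒x∈p-y y∈p y≢x)

module _ {n} (a : Adj n) where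

  x∈N⁻ : ∀ {u x} → x ∈ N a u → a u x ≡ true
  x∈N⁻ {u} {x} x∈N = trans (sym (lookup∘tabulate (a u) x)) ([]=⇒lookup x∈N)

  x∈N⁺ : ∀ {u x} → a u x ≡ true → x ∈ N a u
  x∈N⁺ {u} {x} aux = lookup⇒[]= x _ (trans (lookup∘tabulate (a u) x) aux)

  N⊆B∪white : ∀ B u → N a u ⊆ B ∪ white a B u
  N⊆B∪white B u {x} x∈N with x ∈? B
  ... | yes x∈B = p⊆p∪q (white a B u) x∈B
  ... | no  x∉B = q⊆p∪q B (white a B u) (x∈p∩q⁺ (x∈N , x∉p⇒x∈∁p x∉B))

  white-after-delete : ∀ {S c w} → N a c ⊆ S → w ∈ N a c → white a (S - w) c ≡ ⁅ w ⁆
  white-after-delete {S} {c} {w} N⊆S w∈N = ⊆-antisym ⊆⁅w⁆ ⁅w⁆⊆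
    where
    ⊆⁅w⁆ : white a (S - w) c ⊆ ⁅ w ⁆
    ⊆⁅w⁆ {y} y∈ with x∈p∩q⁻ (N a c) (∁ (S - w)) y∈ | y ≟ᶠ w
    ... | _          | yes refl = x∈⁅x⁆ w
    ... | y∈N , y∈∁  | no y≢w   = ⊥-elim (x∈∁p⇒x∉p y∈∁ (x∈p∧x≢y⇒x∈p-y (N⊆S y∈N) y≢w))
    ⁅w⁆⊆ : ⁅ w ⁆ ⊆ white a (S - w) c
    ⁅w⁆⊆ y∈ rewrite x∈⁅y⁆⇒x≡y w y∈ =
      x∈p∩q⁺ (w∈N , x∉p⇒x∈∁p λ w∈S-w → x∈p─q⇒x∉q S ⁅ w ⁆ w∈S-w (x∈⁅x⁆ w))

  skewStep-delete : ∀ {S c w} → N a c ⊆ S → w ∈ N a c → SkewStep a (S - w) S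
  skewStep-delete {S} {c} {w} N⊆S w∈N = subst (SkewStep a (S - w)) restored
    (force (S - w) c (trans (cong ∣_∣ white≡⁅w⁆) (∣⁅x⁆∣≡1 w)))
    where
    white≡⁅w⁆ : white a (S - w) c ≡ ⁅ w ⁆
    white≡⁅w⁆ = white-after-delete N⊆S w∈N
    restored : (S - w) ∪ white a (S - w) c ≡ S
    restored = trans (cong ((S - w) ∪_) white≡⁅w⁆) (x∈p⇒p-x∪⁅x⁆≡p (N⊆S w∈N))

module _ {n} (G : SimpleGraph n) (r : ℕ) where

  private
    a : Adj (n * r)
    a = blowupAdj G r

  HasWhiteIn : Subset (n * r) → Fin n → Set
  HasWhiteIn B v = ∃[ x ] quotient r x ≡ v × x ∉ B

  record SkewShadow (B : Subset (n * r)) : Set where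
    field
      S          : Subset n
      forcing    : SkewForcingSet G S
      white-outside : ∀ v → v ∉ S → HasWhiteIn B v
      size       : r * ∣ S ∣ ≤ ∣ B ∣

  shadow-⊤ : SkewShadow ⊤
  shadow-⊤ = record
    { S          = ⊤
    ; forcing    = ε
    ; white-outside = λ v v∉⊤ → ⊥-elim (v∉⊤ ∈⊤)
    ; size       = ℕ.≤-reflexive (begin
        r * ∣ ⊤ {n} ∣ ≡⟨ cong (r *_) (∣⊤∣≡n n) ⟩
        r * n         ≡⟨ ℕ.*-comm r n ⟩
        n * r         ≡⟨ sym (∣⊤∣≡n (n * r)) ⟩
        ∣ ⊤ {n * r} ∣ ∎)
    }
    where open ≡-Reasoning

  module _ (B : Subset (n * r)) (u : Fin (n * r)) where

    private
      W : Subset (n * r)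
      W = white a B u
      c : Fin n
      c = quotient r u

    N-class⊆shadow : (sh : SkewShadow (B ∪ W)) → N (adj G) c ⊆ SkewShadow.S sh
    N-class⊆shadow sh {v} v∈N with v ∈? SkewShadow.S sh
    ... | yes v∈S = v∈S
    ... | no  v∉S with SkewShadow.white-outside sh v v∉S
    ... | x , refl , x∉B∪W = ⊥-elim (x∉B∪W (N⊆B∪white a B u (x∈N⁺ a (x∈N⁻ (adj G) v∈N))))

    shadow-step : ∣ W ∣ ≤ r → SkewShadow (B ∪ W) → SkewShadow B
    shadow-step ∣W∣≤r sh with nonempty? W
    ... | no W-empty = subst SkewShadow B∪W≡B sh
      where
      B∪W≡B : B ∪ W ≡ B
      B∪W≡B = trans (cong (B ∪_) (Empty-unique W-empty)) (∪-identityʳ B)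
    ... | yes (x , x∈W) = record
      { S          = S - w
      ; forcing    = skewStep-delete (adj G) N⊆S w∈N ◅ forcing
      ; white-outside = white-outside′
      ; size       = size′
      }
      where
      open SkewShadow sh
      w : Fin n
      w = quotient r x
      x∈N×x∈∁B : x ∈ N a u × x ∈ ∁ B
      x∈N×x∈∁B = x∈p∩q⁻ (N a u) (∁ B) x∈W
      N⊆S : N (adj G) c ⊆ S
      N⊆S = N-class⊆shadow sh
      w∈N : w ∈ N (adj G) c
      w∈N = x∈N⁺ (adj G) (x∈N⁻ a (proj₁ x∈N×x∈∁B))

      white-outside′ : ∀ v → v ∉ S - w → HasWhiteIn B v
      white-outside′ v v∉S-w with v ≟ᶠ w
      ... | yes refl = x , refl , x∈∁p⇒x∉p (proj₂ x∈N×x∈∁B)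
      ... | no  v≢w with white-outside v (λ v∈S → v∉S-w (x∈p∧x≢y⇒x∈p-y v∈S v≢w))
      ... | y , qy , y∉B∪W = y , qy , λ y∈B → y∉B∪W (p⊆p∪q W y∈B)

      size′ : r * ∣ S - w ∣ ≤ ∣ B ∣
      size′ = ℕ.+-cancelʳ-≤ r (r * ∣ S - w ∣) ∣ B ∣ (begin
        r * ∣ S - w ∣ + r ≡⟨ ℕ.+-comm (r * ∣ S - w ∣) r ⟩
        r + r * ∣ S - w ∣ ≡⟨ sym (ℕ.*-suc r ∣ S - w ∣) ⟩
        r * suc ∣ S - w ∣ ≤⟨ ℕ.*-monoʳ-≤ r (x∈p⇒∣p-x∣<∣p∣ (N⊆S w∈N)) ⟩
        r * ∣ S ∣         ≤⟨ size ⟩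
        ∣ B ∪ W ∣         ≤⟨ ∣p∪q∣≤∣p∣+∣q∣ B W ⟩
        ∣ B ∣ + ∣ W ∣     ≤⟨ ℕ.+-monoʳ-≤ ∣ B ∣ ∣W∣≤r ⟩
        ∣ B ∣ + r         ∎)
        where open ℕ.≤-Reasoning

  shadow : ∀ {B} → FoldForcingSet G r B → SkewShadow B
  shadow ε                            = shadow-⊤
  shadow (force B u _ ∣W∣≤r ◅ steps) = shadow-step B u ∣W∣≤r (shadow steps)

proposition3p17 : ∀ {n} (G : SimpleGraph n) (r : ℕ) → 2 ≤ r →
    ∀ z zr → IsZskew G z → IsZfold G r zr → r * z ≤ zr
proposition3p17 G r _ z zr (_ , z-minimal) ((B , B-forces , ∣B∣≡zr) , _) = begin
  r * z     ≤⟨ ℕ.*-monoʳ-≤ r (z-minimal S forcing) ⟩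
  r * ∣ S ∣ ≤⟨ size ⟩
  ∣ B ∣     ≡⟨ ∣B∣≡zr ⟩
  zr        ∎
  where
  open SkewShadow (shadow G r B-forces)
  open ℕ.≤-Reasoning
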